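{- Let $\Gamma$ be a simple digraph, let $k\ge 0$ be an integer, let $B\subseteq V(\Gamma)$ be a zero forcing set of $\Gamma$ with $|B|=k$ and $\operatorname{pt}(\Gamma;B)=\operatorname{pt}_k(\Gamma)$, and let $\mathcal F$ be a set of forces of $B$ with $\operatorname{pt}(\Gamma;\mathcal F)=\operatorname{pt}(\Gamma;B)$. Then $\operatorname{pt}(\Gamma;B)=\operatorname{pt}(\Gamma^T;\operatorname{Term}(\mathcal F))$.
   Context: A simple digraph has a finite vertex set and no loops or parallel arcs (opposite arcs allowed); $\Gamma^T$ is obtained by reversing every arc. $v$ is an out-neighbor of $u$ if $(u,v)$ is an arc. Zero forcing: vertices are blue or white; a blue vertex $u$ with exactly one white out-neighbor $w$ may force $w$ ($u\to w$), turning it blue. A set $\mathcal F$ of forces is a set of forces of $B\subseteq V(\Gamma)$ if, starting with exactly $B$ blue, the forces in $\mathcal F$ can be validly performed in some order after which no further force is possible. Put $\mathcal F^{[0]}=B$ and $\mathcal F^{[t+1]}=\mathcal F^{[t]}\cup\{w\notin\mathcal F^{[t]}:(u\to w)\in\mathcal F,\ u\in\mathcal F^{[t]},\ w$ the only out-neighbor of $u$ outside $\mathcal F^{[t]}\}$; $\operatorname{pt}(\Gamma;\mathcal F)$ is the least $t$ with $\mathcal F^{[t]}=V(\Gamma)$ ($\infty$ if none); $\operatorname{pt}(\Gamma;B)=\min_{\mathcal F}\operatorname{pt}(\Gamma;\mathcal F)$ over sets of forces of $B$; $B$ is a zero forcing set if all vertices become blue. The terminus $\operatorname{Term}(\mathcal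 F)$ is the set of vertices that do not perform a force in $\mathcal F$. The $k$-propagation time is $\operatorname{pt}_k(\Gamma)=\min\{\operatorname{pt}(\Gamma;B): B$ a zero forcing set of $\Gamma$ with $|B|=k\}$. -}

module Defs where

open import Data.Nat using (ℕ; zero; suc; _+_; _≤_)
open import Data.Fin using (Fin; zero; suc; _≟_)
open import Data.Bool using (Bool; true; false; _∧_; _∨_; not; if_then_else_)
open import Data.Maybe using (Maybe; just; nothing)
open import Data.Product using (Σ; _×_; _,_)
open import Data.List using (List; []; _∷_)
open import Data.List.Membership.Propositional using (_∈_)
open import Function using (_⇔_; flip; _∘_)
open import Relation.Nullary using (¬_)
open import Relation.Nullary.Decidable using (⌊_⌋)
open import Relation.Binary.PropositionalEquality using (_≡_)

-- A simple digraph on vertex set Fin n: arcs given by a Boolean relation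
-- (so no parallel arcs), with no loops.  Opposite arcs are allowed.
record Digraph (n : ℕ) : Set where
  field
    arc      : Fin n → Fin n → Bool
    loopless : ∀ v → arc v v ≡ false
open Digraph public

transpose : ∀ {n} → Digraph n → Digraph n
transpose Γ = record { arc = flip (arc Γ) ; loopless = loopless Γ }

VSet : ℕ → Set
VSet n = Fin n → Bool

-- Sets of forces: a set of ordered pairs (u , w), meaning u → w.
ForceSet : ℕ → Set
ForceSet n = Fin n → Fin n → Bool

anyFin : ∀ {n} → (Fin n → Bool) → Bool
anyFin {zero}  p = false
anyFin {suc n} p = p zero ∨ anyFin (p ∘ suc)

allFin : ∀ {n} → (Fin n → Bool) → Bool
allFin {zero}  p = true
allFin {suc n} p = p zero ∧ allFin (p ∘ suc)

count : ∀ {n} → VSet n → ℕ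
count {zero}  S = 0
count {suc n} S = (if S zero then 1 else 0) + count (S ∘ suc)

insert : ∀ {n} → Fin n → VSet n → VSet n
insert w S x = ⌊ x ≟ w ⌋ ∨ S x

ValidForce : ∀ {n} → Digraph n → VSet n → Fin n → Fin n → Set
ValidForce Γ S u w =
  (S u ≡ true) × (S w ≡ false) × (arc Γ u w ≡ true) ×
  (∀ x → arc Γ u x ≡ true → S x ≡ false → x ≡ w)

data Performs {n} (Γ : Digraph n) : VSet n → List (Fin n × Fin n) → VSet n → Set where
  done : ∀ {S} → Performs Γ S [] S
  step : ∀ {S u w L S'} → ValidForce Γ S u w →
         Performs Γ (insert w S) L S' → Performs Γ S ((u , w) ∷ L) S'

Stuck : ∀ {n} → Digraph n → VSet n → Set
Stuck Γ S = ∀ u w → ¬ ValidForce Γ S u w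

IsSetOfForces : ∀ {n} → Digraph n → VSet n → ForceSet n → Set
IsSetOfForces {n} Γ B F =
  Σ (List (Fin n × Fin n)) λ L → Σ (VSet n) λ S' →
    (∀ u w → (F u w ≡ true) ⇔ ((u , w) ∈ L)) ×
    Performs Γ B L S' × Stuck Γ S'

IsZFS : ∀ {n} → Digraph n → VSet n → Set
IsZFS {n} Γ B = Σ (List (Fin n × Fin n)) λ L → Σ (VSet n) λ S' →
  Performs Γ B L S' × (∀ v → S' v ≡ true)

Term : ∀ {n} → ForceSet n → VSet n
Term F v = not (anyFin (F v))

onlyWhite : ∀ {n} → Digraph n → VSet n → Fin n → Fin n → Bool
onlyWhite Γ S u w =
  arc Γ u w ∧ not (S w) ∧ allFin (λ x → not (arc Γ u x) ∨ S x ∨ ⌊ x ≟ w ⌋)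

stepF : ∀ {n} → Digraph n → ForceSet n → VSet n → VSet n
stepF Γ F S w = S w ∨ anyFin (λ u → F u w ∧ S u ∧ onlyWhite Γ S u w)

iterF : ∀ {n} → Digraph n → ForceSet n → VSet n → ℕ → VSet n
iterF Γ F B zero    = B
iterF Γ F B (suc t) = stepF Γ F (iterF Γ F B t)

Reaches : ∀ {n} → Digraph n → ForceSet n → VSet n → ℕ → Set
Reaches Γ F B t = ∀ v → iterF Γ F B t v ≡ true

-- Least P m : m is the minimum of {t | P t}, with nothing = ∞ (empty set).
Least : (ℕ → Set) → Maybe ℕ → Set
Least P (just t) = P t × (∀ s → P s → t ≤ s)
Least P nothing  = ∀ s → ¬ P s

PtF : ∀ {n} → Digraph n → ForceSet n → VSet n → Maybe ℕ → Set
PtF Γ F B = Least (Reaches Γ F B)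

PtB : ∀ {n} → Digraph n → VSet n → Maybe ℕ → Set
PtB {n} Γ B = Least (λ t → Σ (ForceSet n) λ F → IsSetOfForces Γ B F × Reaches Γ F B t)

PtK : ∀ {n} → Digraph n → ℕ → Maybe ℕ → Set
PtK {n} Γ k = Least (λ t → Σ (VSet n) λ B → IsZFS Γ B × (count B ≡ k) ×
  Σ (ForceSet n) λ F → IsSetOfForces Γ B F × Reaches Γ F B t)

module Submission where

-- Let F be a set of forces of B in Γ, performed
-- in a chronological order L, that colours V(Γ) in t parallel rounds, and let Fᵀ be F
-- with every force reversed.  The module Reversal establishes:
--   (1) the reversed forces of L, performed in the opposite order, form a chronology in
--       Γᵀ from Term F that colours every vertex (reverse-chronology);
--   (2) hence |Term F| = |B|, as both chronologies colour V(Γ) with |L| forces;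
--   (3) Fᵀ colours V(Γ) from Term F in t rounds: if v forces w and w is white after forward
--       round r, then v is blue after reversed round t − r (reversed-rounds).
-- So pt(Γᵀ; Term F) ≤ t.  Conversely, a set of forces G of Term F in Γᵀ finishing in s
-- rounds reverses (Reversal for Γᵀ, whose transpose is Γ) to a k-element zero forcing
-- set Term G of Γ finishing in s rounds, so t = pt_k(Γ) ≤ s.  If p = ∞ the hypotheses
-- are contradictory, since a zero forcing chronology yields a finite propagation time.

open import Defs
open import Data.Nat using (ℕ; zero; suc; _+_; _≤_; _<_; _≤′_; ≤′-reflexive; ≤′-step; z≤n; s≤s)
open import Data.Nat.Properties using (+-suc; +-identityʳ; +-cancelʳ-≡; ≤-refl; m≤n⇒m≤1+n; ≤⇒≤′)
open import Data.Fin using (Fin; zero; suc; _≟_)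
open import Data.Fin.Properties using (suc-injective)
open import Data.Bool using (Bool; true; false; _∧_; _∨_; not; if_then_else_)
open import Data.Maybe using (Maybe; just; nothing)
open import Data.Product using (Σ; _×_; _,_; proj₁; proj₂; swap)
open import Data.Product.Properties using (≡-dec)
open import Data.Sum using (_⊎_; inj₁; inj₂)
open import Data.Empty using (⊥; ⊥-elim)
open import Data.List using (List; []; _∷_; _++_; length; map; reverse)
open import Data.List.Properties using (length-reverse; length-map; unfold-reverse)
open import Data.List.Relation.Unary.Any using (here; there; any?)
open import Data.List.Relation.Unary.Any.Properties using (reverse⁺; reverse⁻)
open import Data.List.Membership.Propositional using (_∈_)
open import Data.List.Membership.Propositional.Properties using (∈-map⁺; ∈-map⁻)
open import Function using (_⇔_; _∘_)
open import Function.Bundles using (Equivalence; mk⇔)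
open import Relation.Nullary using (¬_; Dec; yes; no)
open import Relation.Nullary.Decidable using (⌊_⌋; ⌊⌋-map′)
open import Relation.Binary.PropositionalEquality
  using (_≡_; refl; sym; trans; cong; cong₂; subst; module ≡-Reasoning)

clash : ∀ {b} → b ≡ true → b ≡ false → ⊥
clash refl ()

true-or-false : ∀ b → b ≡ true ⊎ b ≡ false
true-or-false true  = inj₁ refl
true-or-false false = inj₂ refl

∨-introˡ : ∀ {a} b → a ≡ true → a ∨ b ≡ true
∨-introˡ b refl = refl

∨-introʳ : ∀ a {b} → b ≡ true → a ∨ b ≡ true
∨-introʳ false refl = refl
∨-introʳ true  refl = refl

∨-elim : ∀ a b → a ∨ b ≡ true → a ≡ true ⊎ b ≡ true
∨-elim true  b _ = inj₁ refl
∨-elim false b e = inj₂ e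

∧-intro : ∀ {a b} → a ≡ true → b ≡ true → a ∧ b ≡ true
∧-intro refl refl = refl

∧-elim : ∀ a b → a ∧ b ≡ true → a ≡ true × b ≡ true
∧-elim true true _ = refl , refl

not-false : ∀ {a} → a ≡ false → not a ≡ true
not-false refl = refl

not-true⇒false : ∀ {a} → not a ≡ true → a ≡ false
not-true⇒false {false} _ = refl

not-false⇒true : ∀ {a} → not a ≡ false → a ≡ true
not-false⇒true {true} _ = refl

contrapositive : ∀ {a b} → (a ≡ true → b ≡ true) → b ≡ false → a ≡ false
contrapositive {a} a⇒b b≡false with true-or-false a
... | inj₁ a≡true  = ⊥-elim (clash (a⇒b a≡true) b≡false)
... | inj₂ a≡false = a≡false

implication-intro : ∀ a b c → (a ≡ true → b ≡ false → c ≡ true) → not a ∨ b ∨ c ≡ true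
implication-intro false b     c h = refl
implication-intro true  true  c h = refl
implication-intro true  false c h = h refl refl

implication-elim : ∀ a b c → not a ∨ b ∨ c ≡ true → a ≡ true → b ≡ true ⊎ c ≡ true
implication-elim true true  c _ _ = inj₁ refl
implication-elim true false c e _ = inj₂ e

complement : ∀ a b → (a ≡ false → b ≡ true) → (b ≡ true → a ≡ false) → a ≡ not b
complement true  true  _ b⇒¬a = b⇒¬a refl
complement true  false _ _    = refl
complement false true  _ _    = refl
complement false false ¬a⇒b _ = ¬a⇒b refl

⌊⌋-sound : ∀ {P : Set} (d : Dec P) → ⌊ d ⌋ ≡ true → P
⌊⌋-sound (yes p) _ = p

⌊⌋-complete : ∀ {P : Set} (d : Dec P) → P → ⌊ d ⌋ ≡ true
⌊⌋-complete (yes _) _ = refl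
⌊⌋-complete (no ¬p) p = ⊥-elim (¬p p)

⌊⌋-refute : ∀ {P : Set} (d : Dec P) → ¬ P → ⌊ d ⌋ ≡ false
⌊⌋-refute (yes p) ¬p = ⊥-elim (¬p p)
⌊⌋-refute (no _)  _  = refl

anyFin-intro : ∀ {n} (p : Fin n → Bool) i → p i ≡ true → anyFin p ≡ true
anyFin-intro p zero    e = ∨-introˡ _ e
anyFin-intro p (suc i) e = ∨-introʳ (p zero) (anyFin-intro (p ∘ suc) i e)

anyFin-elim : ∀ {n} (p : Fin n → Bool) → anyFin p ≡ true → Σ (Fin n) λ i → p i ≡ true
anyFin-elim {suc n} p e with ∨-elim (p zero) (anyFin (p ∘ suc)) e
... | inj₁ e₀ = zero , e₀
... | inj₂ e₁ with anyFin-elim (p ∘ suc) e₁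
...   | i , pi = suc i , pi

allFin-intro : ∀ {n} (p : Fin n → Bool) → (∀ i → p i ≡ true) → allFin p ≡ true
allFin-intro {zero}  p h = refl
allFin-intro {suc n} p h = ∧-intro (h zero) (allFin-intro (p ∘ suc) (h ∘ suc))

allFin-elim : ∀ {n} (p : Fin n → Bool) → allFin p ≡ true → ∀ i → p i ≡ true
allFin-elim {suc n} p e zero    = proj₁ (∧-elim _ _ e)
allFin-elim {suc n} p e (suc i) = allFin-elim (p ∘ suc) (proj₂ (∧-elim _ _ e)) i

infix 4 _⊆_
_⊆_ : ∀ {n} → VSet n → VSet n → Set
S ⊆ T = ∀ x → S x ≡ true → T x ≡ true

insert-self : ∀ {n} (w : Fin n) S → insert w S w ≡ true
insert-self w S = ∨-introˡ (S w) (⌊⌋-complete (w ≟ w) refl)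

insert-other : ∀ {n} {w x : Fin n} S → ¬ x ≡ w → insert w S x ≡ S x
insert-other {w = w} {x} S x≢w = cong (_∨ S x) (⌊⌋-refute (x ≟ w) x≢w)

insert-grows : ∀ {n} (w : Fin n) S → S ⊆ insert w S
insert-grows w S x = ∨-introʳ _

insert-cases : ∀ {n} {w x : Fin n} S → insert w S x ≡ true → x ≡ w ⊎ S x ≡ true
insert-cases {w = w} {x} S e with ∨-elim ⌊ x ≟ w ⌋ (S x) e
... | inj₁ x≡w = inj₁ (⌊⌋-sound (x ≟ w) x≡w)
... | inj₂ Sx  = inj₂ Sx

insert-suc : ∀ {n} (w x : Fin n) (S : VSet (suc n)) → insert (suc w) S (suc x) ≡ insert w (S ∘ suc) x
insert-suc w x S = cong (_∨ S (suc x)) (⌊⌋-map′ (cong suc) suc-injective (x ≟ w))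

indicator : Bool → ℕ
indicator b = if b then 1 else 0

count-cong : ∀ {n} (S T : VSet n) → (∀ x → S x ≡ T x) → count S ≡ count T
count-cong {zero}  S T h = refl
count-cong {suc n} S T h =
  cong₂ (λ b c → indicator b + c) (h zero) (count-cong (S ∘ suc) (T ∘ suc) (h ∘ suc))

count-full : ∀ {n} (S T : VSet n) → (∀ x → S x ≡ true) → (∀ x → T x ≡ true) → count S ≡ count T
count-full S T fullS fullT = count-cong S T (λ x → trans (fullS x) (sym (fullT x)))

count-insert : ∀ {n} (w : Fin n) (S : VSet n) → S w ≡ false → count (insert w S) ≡ suc (count S)
count-insert zero    S Sw = cong (λ b → suc (indicator b + count (S ∘ suc))) (sym Sw)
count-insert (suc w) S Sw = begin
  indicator (S zero) + count (insert (suc w) S ∘ suc)  ≡⟨ cong (indicator (S zero) +_) (count-cong _ _ (λ x → insert-suc w x S)) ⟩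
  indicator (S zero) + count (insert w (S ∘ suc))      ≡⟨ cong (indicator (S zero) +_) (count-insert w (S ∘ suc) Sw) ⟩
  indicator (S zero) + suc (count (S ∘ suc))           ≡⟨ +-suc (indicator (S zero)) (count (S ∘ suc)) ⟩
  suc (count S)                                        ∎
  where open ≡-Reasoning

module Chronology {n} (Γ : Digraph n) where

  performs-++ : ∀ {S L M K S'} → Performs Γ S L M → Performs Γ M K S' → Performs Γ S (L ++ K) S'
  performs-++ done         q = q
  performs-++ (step vf p) q = step vf (performs-++ p q)

  -- Each force colours exactly one new vertex.
  performs-count : ∀ {S L S'} → Performs Γ S L S' → count S' ≡ count S + length L
  performs-count {S} done = sym (+-identityʳ (count S))
  performs-count {S} {S' = S'} (step {w = w} {L = L} (_ , Sw , _ , _) p) = begin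
    count S'                       ≡⟨ performs-count p ⟩
    count (insert w S) + length L  ≡⟨ cong (_+ length L) (count-insert w S Sw) ⟩
    suc (count S) + length L       ≡⟨ sym (+-suc (count S) (length L)) ⟩
    count S + suc (length L)       ∎
    where open ≡-Reasoning

  performs-grows : ∀ {S L S'} → Performs Γ S L S' → S ⊆ S'
  performs-grows done                       x e = e
  performs-grows (step {S = S} {w = w} _ p) x e = performs-grows p x (insert-grows w S x e)

  forced-arc : ∀ {S L S' u w} → Performs Γ S L S' → (u , w) ∈ L → arc Γ u w ≡ true
  forced-arc (step (_ , _ , a , _) p) (here refl) = a
  forced-arc (step _ p)               (there m)   = forced-arc p m

  forced-white : ∀ {S L S' u w} → Performs Γ S L S' → (u , w) ∈ L → S w ≡ false
  forced-white (step (_ , Sw , _ , _) p)    (here refl) = Sw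
  forced-white (step {S = S} {w = w} _ p)  (there m)   =
    contrapositive (insert-grows w S _) (forced-white p m)

  forced-blue : ∀ {S L S' u w} → Performs Γ S L S' → (u , w) ∈ L → S' w ≡ true
  forced-blue (step {S = S} {w = w} _ p) (here refl) = performs-grows p w (insert-self w S)
  forced-blue (step _ p)                 (there m)   = forced-blue p m

  -- A vertex is forced at most once: later forces target vertices white after it.
  forced-once : ∀ {S L S' u u' w} → Performs Γ S L S' → (u , w) ∈ L → (u' , w) ∈ L → u ≡ u'
  forced-once (step _ p) (here refl) (here refl) = refl
  forced-once (step {S = S} {w = w} _ p) (here refl) (there m) =
    ⊥-elim (clash (insert-self w S) (forced-white p m))
  forced-once (step {S = S} {w = w} _ p) (there m) (here refl) =
    ⊥-elim (clash (insert-self w S) (forced-white p m))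
  forced-once (step _ p) (there m) (there m') = forced-once p m m'

  full-stuck : ∀ {S} → (∀ x → S x ≡ true) → Stuck Γ S
  full-stuck full u w (_ , Sw , _) = clash (full w) Sw

module SetOfForces {n} {Γ : Digraph n} {B : VSet n} {F : ForceSet n}
                   (sof : IsSetOfForces Γ B F) where
  open Chronology Γ

  chronology : List (Fin n × Fin n)
  chronology = proj₁ sof

  final : VSet n
  final = proj₁ (proj₂ sof)

  performed : Performs Γ B chronology final
  performed = proj₁ (proj₂ (proj₂ (proj₂ sof)))

  listed : ∀ {u w} → F u w ≡ true → (u , w) ∈ chronology
  listed {u} {w} = Equivalence.to (proj₁ (proj₂ (proj₂ sof)) u w)

  unlisted : ∀ {u w} → (u , w) ∈ chronology → F u w ≡ true
  unlisted {u} {w} = Equivalence.from (proj₁ (proj₂ (proj₂ sof)) u w)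

  force-arc : ∀ {u w} → F u w ≡ true → arc Γ u w ≡ true
  force-arc = forced-arc performed ∘ listed

  target-white : ∀ {u w} → F u w ≡ true → B w ≡ false
  target-white = forced-white performed ∘ listed

  unique-forcer : ∀ {u u' w} → F u w ≡ true → F u' w ≡ true → u ≡ u'
  unique-forcer Fuw Fu'w = forced-once performed (listed Fuw) (listed Fu'w)

terminal-or-forcer : ∀ {n} (F : ForceSet n) x → Term F x ≡ true ⊎ Σ (Fin n) λ y → F x y ≡ true
terminal-or-forcer F x with true-or-false (anyFin (F x))
... | inj₁ forces = inj₂ (anyFin-elim (F x) forces)
... | inj₂ idle   = inj₁ (not-false idle)

forcer-not-terminal : ∀ {n} (F : ForceSet n) {x y} → F x y ≡ true → Term F x ≡ false
forcer-not-terminal F {x} {y} Fxy = cong not (anyFin-intro (F x) y Fxy)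

validForce-onlyWhite : ∀ {n} (Γ : Digraph n) {S u w} → ValidForce Γ S u w → onlyWhite Γ S u w ≡ true
validForce-onlyWhite Γ {S} {u} {w} (_ , Sw , a , only) =
  ∧-intro a (∧-intro (not-false Sw) (allFin-intro _ λ x →
    implication-intro (arc Γ u x) (S x) ⌊ x ≟ w ⌋
      (λ aux Sx → ⌊⌋-complete (x ≟ w) (only x aux Sx))))

onlyWhite-validForce : ∀ {n} (Γ : Digraph n) {S u w} → S u ≡ true → onlyWhite Γ S u w ≡ true →
  ValidForce Γ S u w
onlyWhite-validForce Γ {S} {u} {w} Su ow with ∧-elim (arc Γ u w) _ ow
... | a , rest with ∧-elim (not (S w)) _ rest
... | ¬Sw , others = Su , not-true⇒false ¬Sw , a , λ x aux Sx →
  other x aux Sx (implication-elim (arc Γ u x) (S x) ⌊ x ≟ w ⌋ (allFin-elim _ others x) aux)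
  where
  other : ∀ x → arc Γ u x ≡ true → S x ≡ false → S x ≡ true ⊎ ⌊ x ≟ w ⌋ ≡ true → x ≡ w
  other x _ Sx (inj₁ Sx') = ⊥-elim (clash Sx' Sx)
  other x _ _  (inj₂ x≡w) = ⌊⌋-sound (x ≟ w) x≡w

validForce-weaken : ∀ {n} (Γ : Digraph n) {S X u w} → S ⊆ X → X w ≡ false →
  ValidForce Γ S u w → ValidForce Γ X u w
validForce-weaken Γ S⊆X Xw (Su , _ , a , only) =
  S⊆X _ Su , Xw , a , λ x aux Xx → only x aux (contrapositive (S⊆X x) Xx)

stepF-grows : ∀ {n} (Γ : Digraph n) F S → S ⊆ stepF Γ F S
stepF-grows Γ F S x = ∨-introˡ _

stepF-force : ∀ {n} (Γ : Digraph n) (F : ForceSet n) {S u w} → F u w ≡ true →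
  ValidForce Γ S u w → stepF Γ F S w ≡ true
stepF-force Γ F {S} {u} {w} Fuw vf@(Su , _ , _ , _) =
  ∨-introʳ (S w) (anyFin-intro _ u (∧-intro Fuw (∧-intro Su (validForce-onlyWhite Γ vf))))

stepF-cases : ∀ {n} (Γ : Digraph n) (F : ForceSet n) {S w} → stepF Γ F S w ≡ true →
  S w ≡ true ⊎ Σ (Fin n) λ u → F u w ≡ true × ValidForce Γ S u w
stepF-cases Γ F {S} {w} e with ∨-elim (S w) _ e
... | inj₁ Sw = inj₁ Sw
... | inj₂ some with anyFin-elim _ some
... | u , c with ∧-elim (F u w) _ c
... | Fuw , c' with ∧-elim (S u) _ c'
... | Su , ow = inj₂ (u , Fuw , onlyWhite-validForce Γ Su ow)

iterF-mono : ∀ {n} (Γ : Digraph n) F B {j m} → j ≤ m → iterF Γ F B j ⊆ iterF Γ F B m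
iterF-mono Γ F B j≤m = go (≤⇒≤′ j≤m)
  where
  go : ∀ {j m} → j ≤′ m → iterF Γ F B j ⊆ iterF Γ F B m
  go (≤′-reflexive refl) x e = e
  go (≤′-step {n = m} j≤′m) x e = stepF-grows Γ F (iterF Γ F B m) x (go j≤′m x e)

forced-in-round : ∀ {n} (Γ : Digraph n) F B m {y} → iterF Γ F B m y ≡ true → B y ≡ false →
  Σ ℕ λ j → j < m × Σ (Fin n) λ u → F u y ≡ true × ValidForce Γ (iterF Γ F B j) u y
forced-in-round Γ F B zero    By By≡false = ⊥-elim (clash By By≡false)
forced-in-round Γ F B (suc m) e By≡false with stepF-cases Γ F {iterF Γ F B m} e
... | inj₂ (u , Fuy , vf) = m , ≤-refl , u , Fuy , vf
... | inj₁ earlier with forced-in-round Γ F B m earlier By≡false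
...   | j , j<m , rest = j , m≤n⇒m≤1+n j<m , rest

chronology-rounds : ∀ {n} (Γ : Digraph n) F B {S L S'} → Performs Γ S L S' →
  (∀ {u w} → (u , w) ∈ L → F u w ≡ true) →
  ∀ j → S ⊆ iterF Γ F B j → S' ⊆ iterF Γ F B (j + length L)
chronology-rounds Γ F B {S} done _ j S⊆ =
  subst (λ m → S ⊆ iterF Γ F B m) (sym (+-identityʳ j)) S⊆
chronology-rounds Γ F B {S' = S'} (step {S = S} {u} {w} {L} vf p) inF j S⊆ =
  subst (λ m → S' ⊆ iterF Γ F B m) (sym (+-suc j (length L)))
    (chronology-rounds Γ F B p (inF ∘ there) (suc j) next)
  where
  next : insert w S ⊆ iterF Γ F B (suc j)
  next x e with insert-cases S e
  ... | inj₂ Sx   = stepF-grows Γ F (iterF Γ F B j) x (S⊆ x Sx)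
  ... | inj₁ refl with true-or-false (iterF Γ F B j x)
  ...   | inj₁ blue  = stepF-grows Γ F (iterF Γ F B j) x blue
  ...   | inj₂ white = stepF-force Γ F (inF (here refl)) (validForce-weaken Γ S⊆ white vf)

rounds-within-chronology : ∀ {n} {Γ : Digraph n} {B F} (sof : IsSetOfForces Γ B F) →
  ∀ j → iterF Γ F B j ⊆ SetOfForces.final sof
rounds-within-chronology {Γ = Γ} {B} {F} sof = within
  where
  open SetOfForces sof
  within : ∀ j → iterF Γ F B j ⊆ final
  within zero    x e = Chronology.performs-grows Γ performed x e
  within (suc j) x e with stepF-cases Γ F {iterF Γ F B j} e
  ... | inj₁ earlier        = within j x earlier
  ... | inj₂ (u , Fux , _) = Chronology.forced-blue Γ performed (listed Fux)

-- A zero forcing set colours everything in finitely many rounds of some set of forces,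
-- namely of the forces listed in a chronology that colours every vertex.
zeroForcing-finishes : ∀ {n} (Γ : Digraph n) B → IsZFS Γ B →
  Σ ℕ λ t → Σ (ForceSet n) λ F → IsSetOfForces Γ B F × Reaches Γ F B t
zeroForcing-finishes {n} Γ B (L , S , performed , full) =
  length L , F , (L , S , (λ u w → mk⇔ (⌊⌋-sound (listed? u w)) (⌊⌋-complete (listed? u w))) ,
                  performed , Chronology.full-stuck Γ full) ,
  λ x → chronology-rounds Γ F B performed (λ {u} {w} → ⌊⌋-complete (listed? u w)) 0 (λ _ e → e) x (full x)
  where
  listed? : ∀ u w → Dec ((u , w) ∈ L)
  listed? u w = any? (≡-dec _≟_ _≟_ (u , w)) L
  F : ForceSet n
  F u w = ⌊ listed? u w ⌋

reverseForces : ∀ {n} → List (Fin n × Fin n) → List (Fin n × Fin n)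
reverseForces L = reverse (map swap L)

∈-reverseForces : ∀ {n} {L : List (Fin n × Fin n)} {u w} → (u , w) ∈ reverseForces L ⇔ (w , u) ∈ L
∈-reverseForces {L = L} = mk⇔ to (reverse⁺ ∘ ∈-map⁺ swap)
  where
  to : ∀ {u w} → (u , w) ∈ reverseForces L → (w , u) ∈ L
  to m with ∈-map⁻ swap (reverse⁻ m)
  ... | (_ , _) , m' , refl = m'

-- The invariant for undoing a chronology L performed from S, going backwards in Γᵀ:
-- X is where the reversed chronology starts and P holds the forcing vertices whose
-- forces have already been peeled off the front of the original chronology.
record ReversalInvariant {n} (Γ : Digraph n) (S : VSet n) (L : List (Fin n × Fin n))
                         (P X : VSet n) : Set where
  field
    finished : ∀ p → P p ≡ true → S p ≡ true × (∀ x → arc Γ p x ≡ true → S x ≡ true)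
    disjoint : ∀ x → P x ≡ true → X x ≡ false
    forcers-outside : ∀ x y → (x , y) ∈ L → X x ≡ false
    covered : ∀ x → X x ≡ false → P x ≡ true ⊎ Σ (Fin n) λ y → (x , y) ∈ L
open ReversalInvariant

module _ {n} {Γ : Digraph n} {S : VSet n} {u w : Fin n} {L : List (Fin n × Fin n)} {P X : VSet n}
         (vf : ValidForce Γ S u w) (inv : ReversalInvariant Γ S ((u , w) ∷ L) P X) where

  -- Once u has forced w, all of u's out-neighbours are blue.
  invariant-step : ReversalInvariant Γ (insert w S) L (insert u P) X
  finished invariant-step p e with insert-cases P e
  ... | inj₂ Pp = insert-grows w S p (proj₁ (finished inv p Pp)) ,
                  λ x a → insert-grows w S x (proj₂ (finished inv p Pp) x a)
  ... | inj₁ refl = insert-grows w S p (proj₁ vf) , neighbour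
    where
    neighbour : ∀ x → arc Γ p x ≡ true → insert w S x ≡ true
    neighbour x a with true-or-false (S x)
    ... | inj₁ Sx = insert-grows w S x Sx
    ... | inj₂ Sx with proj₂ (proj₂ (proj₂ vf)) x a Sx
    ...   | refl = insert-self x S
  disjoint invariant-step x e with insert-cases P e
  ... | inj₁ refl = forcers-outside inv x w (here refl)
  ... | inj₂ Px   = disjoint inv x Px
  forcers-outside invariant-step x y m = forcers-outside inv x y (there m)
  covered invariant-step x Xx with covered inv x Xx
  ... | inj₁ Px              = inj₁ (insert-grows u P x Px)
  ... | inj₂ (y , here refl) = inj₁ (insert-self x P)
  ... | inj₂ (y , there m)   = inj₂ (y , m)

  -- Finished vertices and their out-neighbours are blue while w is still white, so
  -- neither w nor any in-neighbour of w (such as u) is finished.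
  target-unfinished : P w ≡ false
  target-unfinished = contrapositive (λ Pw → proj₁ (finished inv w Pw)) (proj₁ (proj₂ vf))

  in-neighbour-unfinished : ∀ {v} → arc Γ v w ≡ true → P v ≡ false
  in-neighbour-unfinished a = contrapositive (λ Pv → proj₂ (finished inv _ Pv) w a) (proj₁ (proj₂ vf))

  forcer-unfinished : P u ≡ false
  forcer-unfinished = in-neighbour-unfinished (proj₁ (proj₂ (proj₂ vf)))

  reversed-force : ∀ {Y} → (∀ x → Y x ≡ not (insert u P x)) → ValidForce (transpose Γ) Y w u
  reversed-force {Y} Y≗ = Yw , Yu , auw , only
    where
    auw : arc Γ u w ≡ true
    auw = proj₁ (proj₂ (proj₂ vf))
    w≢u : ¬ w ≡ u
    w≢u w≡u = clash (subst (λ v → arc Γ v w ≡ true) (sym w≡u) auw) (loopless Γ w)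
    Yw : Y w ≡ true
    Yw = trans (Y≗ w) (cong not (trans (insert-other P w≢u) target-unfinished))
    Yu : Y u ≡ false
    Yu = trans (Y≗ u) (cong not (insert-self u P))
    only : ∀ x → arc Γ x w ≡ true → Y x ≡ false → x ≡ u
    only x a Yx with insert-cases P (not-false⇒true (trans (sym (Y≗ x)) Yx))
    ... | inj₁ x≡u = x≡u
    ... | inj₂ Px  = ⊥-elim (clash Px (in-neighbour-unfinished a))

  complement-insert : ∀ {Y} → (∀ x → Y x ≡ not (insert u P x)) → ∀ x → insert u Y x ≡ not (P x)
  complement-insert {Y} Y≗ x with x ≟ u
  ... | yes refl = sym (cong not forcer-unfinished)
  ... | no x≢u   = trans (Y≗ x) (cong not (insert-other P x≢u))

reverse-chronology : ∀ {n} {Γ : Digraph n} {S L S' P X} → Performs Γ S L S' →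
  ReversalInvariant Γ S L P X →
  Σ (VSet n) λ Y → Performs (transpose Γ) X (reverseForces L) Y × (∀ x → Y x ≡ not (P x))
reverse-chronology {n} {P = P} {X} done inv =
  X , done , λ x → complement (X x) (P x) (λ Xx → only-P x (covered inv x Xx)) (disjoint inv x)
  where
  only-P : ∀ x → P x ≡ true ⊎ Σ (Fin n) (λ y → (x , y) ∈ []) → P x ≡ true
  only-P x (inj₁ Px) = Px
reverse-chronology {Γ = Γ} {P = P} {X} (step {u = u} {w} {L} vf p) inv
  with reverse-chronology p (invariant-step vf inv)
... | Y , reversed , Y≗ =
  insert u Y ,
  subst (λ K → Performs (transpose Γ) X K (insert u Y)) (sym (unfold-reverse (w , u) (map swap L)))
        (Chronology.performs-++ (transpose Γ) reversed (step (reversed-force vf inv Y≗) done)) ,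
  complement-insert vf inv Y≗

transposeForces : ∀ {n} → ForceSet n → ForceSet n
transposeForces F u w = F w u

module Reversal {n} (Γ : Digraph n) (B : VSet n) (F : ForceSet n)
                (sof : IsSetOfForces Γ B F) (t : ℕ) (reach : Reaches Γ F B t) where
  open SetOfForces sof

  private
    -- Reverse the chronology of F starting from Term F, with no vertex finished yet.
    reversed : Σ (VSet n) λ Y → Performs (transpose Γ) (Term F) (reverseForces chronology) Y ×
                                (∀ x → Y x ≡ not false)
    reversed = reverse-chronology performed record
      { finished        = λ p ()
      ; disjoint        = λ x ()
      ; forcers-outside = λ x y m → forcer-not-terminal F (unlisted m)
      ; covered         = λ x notTerm → inj₂ (forces-in-chronology x notTerm (terminal-or-forcer F x))
      }
      where
      forces-in-chronology : ∀ x → Term F x ≡ false → Term F x ≡ true ⊎ Σ (Fin n) (λ y → F x y ≡ true) →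
                             Σ (Fin n) λ y → (x , y) ∈ chronology
      forces-in-chronology x notTerm (inj₁ terminal) = ⊥-elim (clash terminal notTerm)
      forces-in-chronology x _       (inj₂ (y , Fxy)) = y , listed Fxy

    finalᵀ : VSet n
    finalᵀ = proj₁ reversed

    performedᵀ : Performs (transpose Γ) (Term F) (reverseForces chronology) finalᵀ
    performedᵀ = proj₁ (proj₂ reversed)

    finalᵀ-full : ∀ x → finalᵀ x ≡ true
    finalᵀ-full = proj₂ (proj₂ reversed)

    final-full : ∀ x → final x ≡ true
    final-full x = rounds-within-chronology sof t x (reach x)

  setOfForces : IsSetOfForces (transpose Γ) (Term F) (transposeForces F)
  setOfForces =
    reverseForces chronology , finalᵀ ,
    (λ u w → mk⇔ (Equivalence.from ∈-reverseForces ∘ listed) (unlisted ∘ Equivalence.to ∈-reverseForces)) ,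
    performedᵀ , Chronology.full-stuck (transpose Γ) finalᵀ-full

  zeroForcing : IsZFS (transpose Γ) (Term F)
  zeroForcing = reverseForces chronology , finalᵀ , performedᵀ , finalᵀ-full

  -- Both chronologies colour all n vertices with |L| forces.
  sameSize : count (Term F) ≡ count B
  sameSize = +-cancelʳ-≡ (length chronology) (count (Term F)) (count B) (begin
    count (Term F) + length chronology                   ≡⟨ cong (count (Term F) +_) (sym length-reversed) ⟩
    count (Term F) + length (reverseForces chronology)   ≡⟨ sym (Chronology.performs-count (transpose Γ) performedᵀ) ⟩
    count finalᵀ                                         ≡⟨ count-full finalᵀ final finalᵀ-full final-full ⟩
    count final                                          ≡⟨ Chronology.performs-count Γ performed ⟩
    count B + length chronology                          ∎)
    where
    open ≡-Reasoning
    length-reversed : length (reverseForces chronology) ≡ length chronology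
    length-reversed = trans (length-reverse (map swap chronology)) (length-map swap chronology)

  private
    I : ℕ → VSet n
    I = iterF Γ F B

    R : ℕ → VSet n
    R = iterF (transpose Γ) (transposeForces F) (Term F)

  forcer-before : ∀ {x y r} → F x y ≡ true → I (suc r) y ≡ true →
    I r x ≡ true × (∀ z → arc Γ x z ≡ true → I r z ≡ true ⊎ z ≡ y)
  forcer-before {x} {y} {r} Fxy Iy with forced-in-round Γ F B (suc r) Iy (target-white Fxy)
  ... | j , s≤s j≤r , u , Fuy , (Iu , _ , _ , only) with unique-forcer Fuy Fxy
  ... | refl = iterF-mono Γ F B j≤r x Iu , neighbour
    where
    neighbour : ∀ z → arc Γ x z ≡ true → I r z ≡ true ⊎ z ≡ y
    neighbour z a with true-or-false (I j z)
    ... | inj₁ Iz = inj₁ (iterF-mono Γ F B j≤r z Iz)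
    ... | inj₂ Iz = inj₂ (only z a Iz)

  -- If v forces w and w is white after forward round r, then v is blue after reversed
  -- round s, where r + s = t.  In the inductive step w itself may force v in Γᵀ.
  reversed-rounds : ∀ s r → r + s ≡ t → ∀ {v w} → F v w ≡ true → I r w ≡ false → R s v ≡ true
  reversed-rounds zero r r+0≡t {w = w} _ Iw =
    ⊥-elim (clash (reach w) (subst (λ m → I m w ≡ false) (trans (sym (+-identityʳ r)) r+0≡t) Iw))
  reversed-rounds (suc s) r r+s≡t {v} {w} Fvw Iw with true-or-false (R s v)
  ... | inj₁ Rv = stepF-grows (transpose Γ) (transposeForces F) (R s) v Rv
  ... | inj₂ Rv = stepF-force (transpose Γ) (transposeForces F) Fvw (Rw , Rv , force-arc Fvw , only)
    where
    blue-or-early : ∀ x → R s x ≡ true ⊎ Σ (Fin n) λ y → F x y ≡ true × I (suc r) y ≡ true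
    blue-or-early x with terminal-or-forcer F x
    ... | inj₁ Tx = inj₁ (iterF-mono (transpose Γ) (transposeForces F) (Term F) (z≤n {s}) x Tx)
    ... | inj₂ (y , Fxy) with true-or-false (I (suc r) y)
    ...   | inj₁ Iy = inj₂ (y , Fxy , Iy)
    ...   | inj₂ Iy = inj₁ (reversed-rounds s (suc r) (trans (sym (+-suc r s)) r+s≡t) Fxy Iy)
    Rw : R s w ≡ true
    Rw with blue-or-early w
    ... | inj₁ Rw' = Rw'
    ... | inj₂ (_ , Fwy , Iy) = ⊥-elim (clash (proj₁ (forcer-before {r = r} Fwy Iy)) Iw)
    only : ∀ x → arc Γ x w ≡ true → R s x ≡ false → x ≡ v
    only x a Rx with blue-or-early x
    ... | inj₁ Rx' = ⊥-elim (clash Rx' Rx)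
    ... | inj₂ (y , Fxy , Iy) with proj₂ (forcer-before {r = r} Fxy Iy) w a
    ...   | inj₁ Iw' = ⊥-elim (clash Iw' Iw)
    ...   | inj₂ refl = unique-forcer Fxy Fvw

  reaches : Reaches (transpose Γ) (transposeForces F) (Term F) t
  reaches v with terminal-or-forcer F v
  ... | inj₁ Tv = iterF-mono (transpose Γ) (transposeForces F) (Term F) (z≤n {t}) v Tv
  ... | inj₂ (w , Fvw) = reversed-rounds t 0 refl Fvw (target-white Fvw)

proposition2p12 : ∀ {n} (Γ : Digraph n) (k : ℕ) (B : VSet n) (F : ForceSet n) (p : Maybe ℕ) →
    IsZFS Γ B → count B ≡ k → PtB Γ B p → PtK Γ k p →
    IsSetOfForces Γ B F → PtF Γ F B p →
    PtB (transpose Γ) (Term F) p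
proposition2p12 {n} Γ k B F (just t) _ |B|≡k _ (_ , minimal-k) sof (reach , _) =
  (transposeForces F , R.setOfForces , R.reaches) , minimal
  where
  module R = Reversal Γ B F sof t reach
  -- A set of forces G of Term F in Γᵀ finishing in s rounds reverses to a k-element zero
  -- forcing set Term G of Γ finishing in s rounds, so t = pt_k(Γ) ≤ s.
  minimal : ∀ s → Σ (ForceSet n) (λ G → IsSetOfForces (transpose Γ) (Term F) G ×
                                          Reaches (transpose Γ) G (Term F) s) → t ≤ s
  minimal s (G , sofG , reachG) =
    minimal-k s (Term G , RG.zeroForcing , trans RG.sameSize (trans R.sameSize |B|≡k) ,
                 transposeForces G , RG.setOfForces , RG.reaches)
    where module RG = Reversal (transpose Γ) (Term F) G sofG s reachG
proposition2p12 Γ k B F nothing zfs _ never _ _ _ with zeroForcing-finishes Γ B zfs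
... | t , G , sofG , reachG = ⊥-elim (never t (G , sofG , reachG))
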